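{- Let $G$ be a connected loopless multigraph and $\omega=(e_1,\dots,e_m)$ an edge ordering of $G$. For each vertex $v$ let $i_v=\min\{i : e_i\in I_G(v)\}$ and let $\tau_i$ denote the transposition of the endvertices of $e_i$. Then the map $f\colon V_G/\langle\pi_\omega\rangle\to D_G/\langle\phi_\omega\rangle$, $f([v])=[(e_{i_v},v,\tau_{i_v}(v))]$, is a well-defined bijection. In particular, $\ell_\omega$ equals the number of orbits of $\phi_\omega$ on $D_G$, i.e. the number of faces of the $2$-cell embedding of $G$ corresponding to the rotation system $\rho_\omega$.
   Context: A graph $G=(V_G,E_G,r_G)$ has finite vertex and edge sets and $r_G$ assigns to each edge two distinct endvertices; $I_G(v)$ is the set of edges incident to $v$. For an edge $e$ with endvertices $u,v$, $\tau_e=(u\ v)$; for $\omega=(e_1,\dots,e_m)$, $\pi_\omega=\tau_{e_m}\cdots\tau_{e_1}$, and $\ell_\omega$ is the number of orbits of $\langle\pi_\omega\rangle$ on $V_G$. Darts: $D_G=\{(e,u,v)\in E_G\times V_G\times V_G: r_G(e)=\{u,v\}\}$, with involution $\alpha(e,u,v)=(e,v,u)$. A rotation system $\rho=(\rho_v)_{v\in V_G}$ consists of a cyclic order $\rho_v=[e_1,\dots,e_s]$ on each $I_G(v)$; it defines $\sigma\colon D_G\to D_G$ by $\sigma(e_j,v,u_j)=(e_{j+1},v,u_{j+1})$ (indices mod $s$, $u_j$ the other endvertex of $e_j$), and $\phi=\sigma\circ\alpha$. For an edge ordering $\omega$, $\rho_\omega$ is the rotation system where $\rho_{\omega,v}$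 is the cyclic order on $I_G(v)$ induced by the restriction of $\omega$ to $I_G(v)$; $\sigma_\omega,\phi_\omega$ are the corresponding maps. Rotation systems correspond to $2$-cell embeddings of $G$ into oriented closed surfaces (up to orientation-preserving homeomorphism), the faces of the embedding corresponding to $\rho$ being in bijection with the orbits of $\phi$ on $D_G$. -}

module Defs where

open import Data.Nat using (ℕ; zero; suc)
open import Data.Fin using (Fin; _<_; _≤_)
open import Data.Fin.Properties using (_≟_; _<?_)
open import Data.Fin.Permutation using (Permutation′; _⟨$⟩ʳ_; _⟨$⟩ˡ_)
open import Data.List using (List; []; _∷_; filter; _++_; map; allFin)
open import Data.Product using (Σ; ∃; ∃-syntax; _×_; _,_)
open import Data.Sum using (_⊎_; inj₁; inj₂)
open import Data.Maybe using (Maybe; just; nothing)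
open import Data.Vec using (Vec; lookup)
open import Data.Empty using (⊥-elim)
open import Relation.Nullary using (Dec; yes; no; ¬_)
open import Relation.Nullary.Decidable using (_⊎-dec_)
open import Relation.Binary.PropositionalEquality using (_≡_; _≢_; refl; sym; trans)
open import Relation.Binary.Construct.Closure.ReflexiveTransitive using (Star)
open import Function using (_∘_)

-- A (loopless multi)graph with V_G = Fin nV, E_G = Fin nE;
-- r_G(e) = {src e , tgt e}, the two endvertices being distinct.
record Graph : Set where
  field
    nV nE    : ℕ
    src tgt  : Fin nE → Fin nV
    distinct : ∀ e → src e ≢ tgt e

iter : ∀ {A : Set} → (A → A) → ℕ → A → A
iter g zero    x = x
iter g (suc k) x = g (iter g k x)

-- x and y lie in the same orbit of ⟨g⟩ (g a permutation of a finite set)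
SameOrbit : ∀ {A : Set} → (A → A) → A → A → Set
SameOrbit g x y = ∃[ k ] iter g k x ≡ y

NumOrbits : ∀ {A : Set} → (A → A) → ℕ → Set
NumOrbits {A} g k =
  Σ (Vec A k) λ reps →
    (∀ i j → SameOrbit g (lookup reps i) (lookup reps j) → i ≡ j) ×
    (∀ x → ∃[ i ] SameOrbit g (lookup reps i) x)

module _ (G : Graph) where
  open Graph G

  -- v ∈ r_G(e), i.e. e ∈ I_G(v)
  Incident : Fin nV → Fin nE → Set
  Incident v e = v ≡ src e ⊎ v ≡ tgt e

  incident? : ∀ v e → Dec (Incident v e)
  incident? v e = (v ≟ src e) ⊎-dec (v ≟ tgt e)

  Adj : Fin nV → Fin nV → Set
  Adj u w = ∃[ e ] ((u ≡ src e × w ≡ tgt e) ⊎ (u ≡ tgt e × w ≡ src e))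

  Connected : Set
  Connected = ∀ u w → Star Adj u w

  τ : Fin nE → Fin nV → Fin nV
  τ e x with x ≟ src e
  ... | yes _ = tgt e
  ... | no _ with x ≟ tgt e
  ...   | yes _ = src e
  ...   | no _  = x

  record Dart : Set where
    constructor dart
    field
      edge : Fin nE
      u v  : Fin nV
      ends : (u ≡ src edge × v ≡ tgt edge) ⊎ (u ≡ tgt edge × v ≡ src edge)

  α : Dart → Dart
  α (dart e u v (inj₁ (p , q))) = dart e v u (inj₂ (q , p))
  α (dart e u v (inj₂ (p , q))) = dart e v u (inj₁ (q , p))

  -- edge orderings ω = (e_1,…,e_m): bijections from positions to edges
  EdgeOrdering : Set
  EdgeOrdering = Permutation′ nE

  -- π_ω = τ_{e_m} ⋯ τ_{e_1}  (τ_{e_1} applied first)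
  applySeq : List (Fin nE) → Fin nV → Fin nV
  applySeq []       x = x
  applySeq (e ∷ es) x = applySeq es (τ e x)

  πω : EdgeOrdering → Fin nV → Fin nV
  πω ω = applySeq (map (ω ⟨$⟩ʳ_) (allFin nE))

  search : (ω : EdgeOrdering) → (v : Fin nV) → List (Fin nE) →
           Maybe (Σ (Fin nE) λ j → Incident v (ω ⟨$⟩ʳ j))
  search ω v [] = nothing
  search ω v (j ∷ js) with incident? v (ω ⟨$⟩ʳ j)
  ... | yes p = just (j , p)
  ... | no _  = search ω v js

  mkDart : (e : Fin nE) (v : Fin nV) → Incident v e → Dart
  mkDart e v (inj₁ p) = dart e v (tgt e) (inj₁ (p , refl))
  mkDart e v (inj₂ p) = dart e v (src e) (inj₂ (p , refl))

  -- σ_ω: (e_j,v,u_j) ↦ (e_{j+1},v,u_{j+1}) for the cyclic order ρ_{ω,v} on I_G(v)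
  -- induced by ω: the next edge at v in ω after e, wrapping around to the first.
  σω : EdgeOrdering → Dart → Dart
  σω ω d with search ω (Dart.u d)
                 (filter (λ j → (ω ⟨$⟩ˡ Dart.edge d) <? j) (allFin nE) ++ allFin nE)
  ... | just (j , p) = mkDart (ω ⟨$⟩ʳ j) (Dart.u d) p
  ... | nothing      = d   -- unreachable: e itself is incident to its own endvertex

  φω : EdgeOrdering → Dart → Dart
  φω ω = σω ω ∘ α

  record IsFirstInc (ω : EdgeOrdering) (v : Fin nV) (i : Fin nE) : Set where
    field
      inc : Incident v (ω ⟨$⟩ʳ i)
      min : ∀ j → Incident v (ω ⟨$⟩ʳ j) → i ≤ j

  τ-inc : ∀ e v → Incident v e →
          (v ≡ src e × τ e v ≡ tgt e) ⊎ (v ≡ tgt e × τ e v ≡ src e)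
  τ-inc e v (inj₁ p) with v ≟ src e
  ... | yes _ = inj₁ (p , refl)
  ... | no ¬p = ⊥-elim (¬p p)
  τ-inc e v (inj₂ p) with v ≟ src e
  ... | yes q = ⊥-elim (distinct e (trans (sym q) p))
  ... | no _ with v ≟ tgt e
  ...   | yes _ = inj₂ (p , refl)
  ...   | no ¬p = ⊥-elim (¬p p)

  fω : (ω : EdgeOrdering) (iv : Fin nV → Fin nE) →
       (∀ v → IsFirstInc ω v (iv v)) → Fin nV → Dart
  fω ω iv h v = dart (ω ⟨$⟩ʳ iv v) v (τ (ω ⟨$⟩ʳ iv v) v)
                     (τ-inc (ω ⟨$⟩ʳ iv v) v (IsFirstInc.inc (h v)))

-- Follow a vertex x through π_ω = τ_{e_m} ⋯ τ_{e_1}: it stays put until e_{i_x}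
-- and afterwards moves along each next edge, in the order ω, that is incident to
-- its current position.  These moves are exactly the darts f(x), φ_ω(f(x)), … :
-- φ_ω turns at the head of a dart to the next edge after it in ω, and once no
-- such edge is left it wraps around to the first edge at the current vertex,
-- which gives f(π_ω x).  The darts strictly in between leave their tail later
-- than its first edge, so they are not in the image of f; hence f embeds the
-- π_ω-orbits into the φ_ω-orbits.  Conversely every dart outside the image of f
-- is the φ_ω-image of a dart of smaller position, so every φ_ω-orbit meets the
-- image of f.

module Submission where

open import Defs
open import Data.Nat as ℕ using (ℕ; zero; suc; _+_; _∸_; z≤n; s≤s)
import Data.Nat.Properties as ℕP
open import Data.Nat.Induction using (<-wellFounded)
open import Data.Fin as F using (Fin; toℕ)
import Data.Fin.Properties as FP
import Data.Fin.Induction as FinInd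
open import Data.Fin.Permutation using (_⟨$⟩ʳ_; _⟨$⟩ˡ_; inverseˡ; inverseʳ)
open import Data.List using (List; []; _∷_; filter; _++_; map; allFin)
open import Data.List.Membership.Propositional using (_∈_)
open import Data.List.Membership.Propositional.Properties using (∈-allFin; ∈-filter⁺; ∈-filter⁻)
open import Data.List.Relation.Unary.Any using (here; there)
import Data.List.Relation.Unary.All as All
open import Data.List.Relation.Unary.AllPairs using (AllPairs; []; _∷_)
import Data.List.Relation.Unary.AllPairs.Properties as AllPairs
open import Data.Maybe using (just; nothing)
open import Data.Product using (∃-syntax; _×_; _,_; proj₁; proj₂)
open import Data.Sum using (_⊎_; inj₁; inj₂)
open import Data.Empty using (⊥-elim)
import Data.Vec as V
import Data.Vec.Properties as VP
open import Relation.Nullary using (yes; no; ¬_)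
open import Relation.Unary using (Pred; Decidable)
open import Relation.Binary.PropositionalEquality
open import Induction.WellFounded using (Acc; acc)
open import Axiom.UniquenessOfIdentityProofs using (module Decidable⇒UIP)
open import Function using (_⇔_; mk⇔; _∘_)

module _ {A : Set} (g : A → A) where

  iter-sucʳ : ∀ k x → iter g (suc k) x ≡ iter g k (g x)
  iter-sucʳ zero    x = refl
  iter-sucʳ (suc k) x = cong g (iter-sucʳ k x)

  iter-+ : ∀ a b x → iter g (a + b) x ≡ iter g a (iter g b x)
  iter-+ zero    b x = refl
  iter-+ (suc a) b x = cong g (iter-+ a b x)

  iter-∸ : ∀ {a b} x → b ℕ.≤ a → iter g (a ∸ b) (iter g b x) ≡ iter g a x
  iter-∸ {a} {b} x b≤a = trans (sym (iter-+ (a ∸ b) b x)) (cong (λ n → iter g n x) (ℕP.m∸n+n≡m b≤a))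

  SameOrbit-step : ∀ x → SameOrbit g x (g x)
  SameOrbit-step x = 1 , refl

  SameOrbit-trans : ∀ {x y z} → SameOrbit g x y → SameOrbit g y z → SameOrbit g x z
  SameOrbit-trans {x} (a , refl) (b , refl) = b + a , iter-+ b a x

  SameOrbit-connex : ∀ {x y z} → SameOrbit g x y → SameOrbit g x z →
                     SameOrbit g y z ⊎ SameOrbit g z y
  SameOrbit-connex {x} (a , refl) (b , refl) with ℕP.≤-total a b
  ... | inj₁ a≤b = inj₁ (b ∸ a , iter-∸ x a≤b)
  ... | inj₂ b≤a = inj₂ (a ∸ b , iter-∸ x b≤a)

module FirstReturn {A B : Set} (g : A → A) (h : B → B) (f : A → B)
  (f-injective : ∀ {v w} → f v ≡ f w → v ≡ w)
  (return : ∀ x → ∃[ k ] iter h (suc k) (f x) ≡ f (g x) ×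
                         (∀ j → j ℕ.< k → ∀ w → iter h (suc j) (f x) ≢ f w))
  where

  orbit-preserved : ∀ {v w} → SameOrbit g v w → SameOrbit h (f v) (f w)
  orbit-preserved {v} (s , refl) = along s
    where
    along : ∀ s → SameOrbit h (f v) (f (iter g s v))
    along zero    = 0 , refl
    along (suc s) with return (iter g s v)
    ... | k , back , _ = SameOrbit-trans h (along s) (suc k , back)

  private
    reflect : ∀ m → Acc ℕ._<_ m → ∀ v w → iter h m (f v) ≡ f w → SameOrbit g v w
    reflect zero    _        v w eq = 0 , f-injective eq
    reflect (suc m) (acc rs) v w eq with return v
    ... | k , back , fresh with suc m ℕP.≤? k
    ...   | yes m<k = ⊥-elim (fresh m m<k w eq)
    ...   | no  m≮k = SameOrbit-trans g (SameOrbit-step g v) (reflect (suc m ∸ suc k) (rs shorter) (g v) w eq′)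
      where
      shorter : suc m ∸ suc k ℕ.< suc m
      shorter = s≤s (ℕP.m∸n≤m m k)
      eq′ : iter h (suc m ∸ suc k) (f (g v)) ≡ f w
      eq′ = trans (cong (iter h (suc m ∸ suc k)) (sym back))
                  (trans (iter-∸ h (f v) (ℕP.≰⇒> m≮k)) eq)

  orbit-reflected : ∀ {v w} → SameOrbit h (f v) (f w) → SameOrbit g v w
  orbit-reflected {v} {w} (m , eq) = reflect m (<-wellFounded m) v w eq

NumOrbits-⇔ : ∀ {A B : Set} {g : A → A} {h : B → B} (f : A → B) →
  (∀ {v w} → SameOrbit g v w → SameOrbit h (f v) (f w)) →
  (∀ {v w} → SameOrbit h (f v) (f w) → SameOrbit g v w) →
  (∀ y → ∃[ x ] SameOrbit h (f x) y) →
  ∀ k → NumOrbits g k ⇔ NumOrbits h k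
NumOrbits-⇔ {g = g} {h} f preserved reflected cover k = mk⇔ forth back
  where
  forth : NumOrbits g k → NumOrbits h k
  forth (reps , distinct , covered) = V.map f reps , distinct′ , covered′
    where
    distinct′ : ∀ i j → SameOrbit h (V.lookup (V.map f reps) i) (V.lookup (V.map f reps) j) → i ≡ j
    distinct′ i j o rewrite VP.lookup-map i f reps | VP.lookup-map j f reps = distinct i j (reflected o)
    covered′ : ∀ y → ∃[ i ] SameOrbit h (V.lookup (V.map f reps) i) y
    covered′ y with cover y
    ... | x , fx~y with covered x
    ...   | i , r~x = i , subst (λ z → SameOrbit h z y) (sym (VP.lookup-map i f reps))
                              (SameOrbit-trans h (preserved r~x) fx~y)

  back : NumOrbits h k → NumOrbits g k
  back (reps , distinct , covered) = V.map pre reps , distinct′ , covered′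
    where
    pre : _ → _
    pre y = proj₁ (cover y)
    distinct′ : ∀ i j → SameOrbit g (V.lookup (V.map pre reps) i) (V.lookup (V.map pre reps) j) → i ≡ j
    distinct′ i j o rewrite VP.lookup-map i pre reps | VP.lookup-map j pre reps
      with SameOrbit-connex h (proj₂ (cover (V.lookup reps i)))
             (SameOrbit-trans h (preserved o) (proj₂ (cover (V.lookup reps j))))
    ... | inj₁ ri~rj = distinct i j ri~rj
    ... | inj₂ rj~ri = sym (distinct j i rj~ri)
    covered′ : ∀ x → ∃[ i ] SameOrbit g (V.lookup (V.map pre reps) i) x
    covered′ x with covered (f x)
    ... | i , ri~fx = i , subst (λ z → SameOrbit g z x) (sym (VP.lookup-map i pre reps))
                            (reflected (SameOrbit-trans h (proj₂ (cover (V.lookup reps i))) ri~fx))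

lastBelow : ∀ {n p} {P : Pred (Fin n) p} → Decidable P → ∀ m → m ℕ.≤ n →
            ∃[ i ] (toℕ i ℕ.< m × P i) →
            ∃[ i ] (toℕ i ℕ.< m × P i × (∀ j → toℕ j ℕ.< m → P j → j F.≤ i))
lastBelow P? zero    _    (_ , () , _)
lastBelow {P = P} P? (suc m) m<n (i , i<m+1 , Pi) with P? (F.fromℕ< m<n)
... | yes Pm = F.fromℕ< m<n , ℕP.≤-reflexive (cong suc toℕ-m) , Pm ,
               λ j j<m+1 _ → ℕP.≤-trans (ℕP.≤-pred j<m+1) (ℕP.≤-reflexive (sym toℕ-m))
  where toℕ-m = FP.toℕ-fromℕ< m<n
... | no ¬Pm =
  let k , k<m , Pk , maximal = lastBelow P? m (ℕP.<⇒≤ m<n) (i , below Pi i<m+1 , Pi)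
  in  k , ℕP.m<n⇒m<1+n k<m , Pk , λ j j<m+1 Pj → maximal j (below Pj j<m+1) Pj
  where
  below : ∀ {j} → P j → toℕ j ℕ.< suc m → toℕ j ℕ.< m
  below Pj j<m+1 = ℕP.≤∧≢⇒< (ℕP.≤-pred j<m+1)
    λ j≡m → ¬Pm (subst _ (FP.toℕ-injective (trans j≡m (sym (FP.toℕ-fromℕ< m<n)))) Pj)

module Darts (G : Graph) where
  open Graph G

  τ-src : ∀ e → τ G e (src e) ≡ tgt e
  τ-src e with src e FP.≟ src e
  ... | yes _   = refl
  ... | no  src≢src = ⊥-elim (src≢src refl)

  τ-tgt : ∀ e → τ G e (tgt e) ≡ src e
  τ-tgt e with tgt e FP.≟ src e
  ... | yes tgt≡src = ⊥-elim (distinct e (sym tgt≡src))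
  ... | no  _ with tgt e FP.≟ tgt e
  ...   | yes _   = refl
  ...   | no  tgt≢tgt = ⊥-elim (tgt≢tgt refl)

  τ-fixes : ∀ e v → ¬ Incident G v e → τ G e v ≡ v
  τ-fixes e v ¬inc with v FP.≟ src e
  ... | yes v≡src = ⊥-elim (¬inc (inj₁ v≡src))
  ... | no  _ with v FP.≟ tgt e
  ...   | yes v≡tgt = ⊥-elim (¬inc (inj₂ v≡tgt))
  ...   | no  _     = refl

  head-τ : ∀ (d : Dart G) → Dart.v d ≡ τ G (Dart.edge d) (Dart.u d)
  head-τ (dart e _ _ (inj₁ (refl , refl))) = sym (τ-src e)
  head-τ (dart e _ _ (inj₂ (refl , refl))) = sym (τ-tgt e)

  tail-incident : ∀ (d : Dart G) → Incident G (Dart.u d) (Dart.edge d)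
  tail-incident (dart _ _ _ (inj₁ (u≡src , _))) = inj₁ u≡src
  tail-incident (dart _ _ _ (inj₂ (u≡tgt , _))) = inj₂ u≡tgt

  head-incident : ∀ (d : Dart G) → Incident G (Dart.v d) (Dart.edge d)
  head-incident (dart _ _ _ (inj₁ (_ , v≡tgt))) = inj₂ v≡tgt
  head-incident (dart _ _ _ (inj₂ (_ , v≡src))) = inj₁ v≡src

  -- The endpoint proofs are irrelevant because equality on Fin is decidable.
  dart-≡ : ∀ {d d′ : Dart G} → Dart.edge d ≡ Dart.edge d′ → Dart.u d ≡ Dart.u d′ → d ≡ d′
  dart-≡ {d} {d′} refl refl with trans (head-τ d) (sym (head-τ d′))
  dart-≡ {dart e u v ends} {dart _ _ _ ends′} refl refl | refl = cong (dart e u v) (irrelevant ends ends′)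
    where
    uip : ∀ {a b : Fin nV} (p q : a ≡ b) → p ≡ q
    uip = Decidable⇒UIP.≡-irrelevant FP._≟_
    irrelevant : ∀ (p q : (u ≡ src e × v ≡ tgt e) ⊎ (u ≡ tgt e × v ≡ src e)) → p ≡ q
    irrelevant (inj₁ (a , b)) (inj₁ (c , d)) = cong inj₁ (cong₂ _,_ (uip a c) (uip b d))
    irrelevant (inj₁ (a , _)) (inj₂ (c , _)) = ⊥-elim (distinct e (trans (sym a) c))
    irrelevant (inj₂ (a , _)) (inj₁ (c , _)) = ⊥-elim (distinct e (trans (sym c) a))
    irrelevant (inj₂ (a , b)) (inj₂ (c , d)) = cong inj₂ (cong₂ _,_ (uip a c) (uip b d))

  α-edge : ∀ (d : Dart G) → Dart.edge (α G d) ≡ Dart.edge d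
  α-edge (dart _ _ _ (inj₁ _)) = refl
  α-edge (dart _ _ _ (inj₂ _)) = refl

  α-tail : ∀ (d : Dart G) → Dart.u (α G d) ≡ Dart.v d
  α-tail (dart _ _ _ (inj₁ _)) = refl
  α-tail (dart _ _ _ (inj₂ _)) = refl

  α-head : ∀ (d : Dart G) → Dart.v (α G d) ≡ Dart.u d
  α-head (dart _ _ _ (inj₁ _)) = refl
  α-head (dart _ _ _ (inj₂ _)) = refl

  mkDart-edge : ∀ e v p → Dart.edge (mkDart G e v p) ≡ e
  mkDart-edge _ _ (inj₁ _) = refl
  mkDart-edge _ _ (inj₂ _) = refl

  mkDart-tail : ∀ e v p → Dart.u (mkDart G e v p) ≡ v
  mkDart-tail _ _ (inj₁ _) = refl
  mkDart-tail _ _ (inj₂ _) = refl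

module Rotation (G : Graph) (ω : EdgeOrdering G) where
  open Graph G
  open Darts G

  Inc : Fin nV → Fin nE → Set
  Inc v i = Incident G v (ω ⟨$⟩ʳ i)

  pos : Dart G → Fin nE
  pos d = ω ⟨$⟩ˡ Dart.edge d

  At : Fin nE → Fin nV → Dart G → Set
  At i v d = pos d ≡ i × Dart.u d ≡ v

  At-unique : ∀ {i v} {d d′ : Dart G} → At i v d → At i v d′ → d ≡ d′
  At-unique {d = d} {d′} (refl , refl) (pos≡ , tail≡) =
    dart-≡ (trans (sym (inverseʳ ω)) (trans (cong (ω ⟨$⟩ʳ_) (sym pos≡)) (inverseʳ ω))) (sym tail≡)

  tail-Inc : ∀ (d : Dart G) → Inc (Dart.u d) (pos d)
  tail-Inc d = subst (Incident G (Dart.u d)) (sym (inverseʳ ω)) (tail-incident d)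

  head-Inc : ∀ (d : Dart G) → Inc (Dart.v d) (pos d)
  head-Inc d = subst (Incident G (Dart.v d)) (sym (inverseʳ ω)) (head-incident d)

  Sorted : List (Fin nE) → Set
  Sorted = AllPairs F._<_

  Sorted-head-least : ∀ {h r L} → Sorted (h ∷ L) → r ∈ h ∷ L → h F.≤ r
  Sorted-head-least _          (here refl)  = FP.≤-refl
  Sorted-head-least (h< ∷ _) (there r∈L) = ℕP.<⇒≤ (All.lookup h< r∈L)

  search-none : ∀ v L → (∀ r → r ∈ L → ¬ Inc v r) → search G ω v L ≡ nothing
  search-none v []      _    = refl
  search-none v (h ∷ L) none with incident? G v (ω ⟨$⟩ʳ h)
  ... | yes inc = ⊥-elim (none h (here refl) inc)
  ... | no  _   = search-none v L (λ r r∈L → none r (there r∈L))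

  search-least : ∀ v {q} L → Sorted L → q ∈ L → Inc v q → (∀ r → r ∈ L → Inc v r → q F.≤ r) →
                 ∃[ p ] search G ω v L ≡ just (q , p)
  search-least v (h ∷ L) (h< ∷ sorted) q∈ incq least with incident? G v (ω ⟨$⟩ʳ h)
  ... | yes inch with FP.≤-antisym (Sorted-head-least (h< ∷ sorted) q∈) (least h (here refl) inch)
  ...   | refl = inch , refl
  search-least v (h ∷ L) (_ ∷ sorted) (here refl) incq _ | no ¬inch = ⊥-elim (¬inch incq)
  search-least v (h ∷ L) (_ ∷ sorted) (there q∈L) incq least | no _ =
    search-least v L sorted q∈L incq (λ r r∈L → least r (there r∈L))

  search-++ˡ : ∀ v L₁ L₂ {x} → search G ω v L₁ ≡ just x → search G ω v (L₁ ++ L₂) ≡ just x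
  search-++ˡ v (h ∷ L₁) L₂ found with incident? G v (ω ⟨$⟩ʳ h)
  ... | yes _ = found
  ... | no  _ = search-++ˡ v L₁ L₂ found

  search-++ʳ : ∀ v L₁ L₂ → search G ω v L₁ ≡ nothing → search G ω v (L₁ ++ L₂) ≡ search G ω v L₂
  search-++ʳ v []       L₂ _ = refl
  search-++ʳ v (h ∷ L₁) L₂ none with incident? G v (ω ⟨$⟩ʳ h)
  search-++ʳ v (h ∷ L₁) L₂ () | yes _
  ... | no _ = search-++ʳ v L₁ L₂ none

  allFin-sorted : Sorted (allFin nE)
  allFin-sorted = AllPairs.tabulate⁺-< (λ i<j → i<j)

  after : Dart G → List (Fin nE)
  after d = filter (λ j → pos d FP.<? j) (allFin nE)

  after-sorted : ∀ d → Sorted (after d)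
  after-sorted d = AllPairs.filter⁺ (λ j → pos d FP.<? j) allFin-sorted

  σω-search : ∀ (d : Dart G) {j p} → search G ω (Dart.u d) (after d ++ allFin nE) ≡ just (j , p) →
              At j (Dart.u d) (σω G ω d)
  σω-search d {j} {p} found rewrite found =
    trans (cong (ω ⟨$⟩ˡ_) (mkDart-edge (ω ⟨$⟩ʳ j) (Dart.u d) p)) (inverseˡ ω) , mkDart-tail _ _ p

  σ-next : ∀ (c : Dart G) {v i} → Dart.u c ≡ v → pos c ≡ i →
           ∀ q → Inc v q → i F.< q → (∀ r → i F.< r → Inc v r → q F.≤ r) → At q v (σω G ω c)
  σ-next c refl refl q incq i<q least =
    let q∈after = ∈-filter⁺ (λ j → pos c FP.<? j) (∈-allFin q) i<q
        p , found = search-least (Dart.u c) (after c) (after-sorted c) q∈after incq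
                      (λ r r∈after → least r (proj₂ (∈-filter⁻ (λ j → pos c FP.<? j) {xs = allFin nE} r∈after)))
    in  σω-search c (search-++ˡ (Dart.u c) (after c) (allFin nE) found)

  φ-next : ∀ (d : Dart G) q → Inc (Dart.v d) q → pos d F.< q →
           (∀ r → pos d F.< r → Inc (Dart.v d) r → q F.≤ r) → At q (Dart.v d) (φω G ω d)
  φ-next d = σ-next (α G d) (α-tail d) (cong (ω ⟨$⟩ˡ_) (α-edge d))

module Faces (G : Graph) (ω : EdgeOrdering G) (iv : Fin (Graph.nV G) → Fin (Graph.nE G))
             (hiv : ∀ v → IsFirstInc G ω v (iv v)) where
  open Graph G
  open Darts G
  open Rotation G ω
  open IsFirstInc

  φ : Dart G → Dart G
  φ = φω G ω

  f : Fin nV → Dart G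
  f = fω G ω iv hiv

  f-At : ∀ v → At (iv v) v (f v)
  f-At v = inverseˡ ω , refl

  σ-wrap : ∀ (c : Dart G) {v i} → Dart.u c ≡ v → pos c ≡ i → (∀ r → i F.< r → ¬ Inc v r) →
           At (iv v) v (σω G ω c)
  σ-wrap c refl refl none =
    let nothing-after = search-none (Dart.u c) (after c)
                          (λ r r∈after → none r (proj₂ (∈-filter⁻ (λ j → pos c FP.<? j) {xs = allFin nE} r∈after)))
        p , found = search-least (Dart.u c) (allFin nE) allFin-sorted
                      (∈-allFin _) (inc (hiv (Dart.u c))) (λ r _ → min (hiv (Dart.u c)) r)
    in  σω-search c (trans (search-++ʳ (Dart.u c) (after c) (allFin nE) nothing-after) found)

  Terminal : Dart G → Set
  Terminal d = ∀ r → pos d F.< r → ¬ Inc (Dart.v d) r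

  φ-terminal : ∀ d → Terminal d → φ d ≡ f (Dart.v d)
  φ-terminal d term = At-unique (σ-wrap (α G d) (α-tail d) (cong (ω ⟨$⟩ˡ_) (α-edge d)) term) (f-At (Dart.v d))

  Later : Dart G → Set
  Later d = iv (Dart.u d) F.< pos d

  Later-≢-f : ∀ {d w} → Later d → d ≢ f w
  Later-≢-f later refl = FP.<-irrefl (sym (inverseˡ ω)) later

  At-head : ∀ {i v} (d : Dart G) → At i v d → Dart.v d ≡ τ G (ω ⟨$⟩ʳ i) v
  At-head d (refl , refl) = trans (head-τ d) (cong (λ e → τ G e (Dart.u d)) (sym (inverseʳ ω)))

  record Tail (b : ℕ) (L : List (Fin nE)) : Set where
    field
      sorted   : Sorted L
      complete : ∀ q → b ℕ.≤ toℕ q → q ∈ L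
      bounded  : ∀ q → q ∈ L → b ℕ.≤ toℕ q
  open Tail

  Tail-allFin : Tail 0 (allFin nE)
  Tail-allFin = record { sorted = allFin-sorted ; complete = λ q _ → ∈-allFin q ; bounded = λ _ _ → z≤n }

  Tail-[] : ∀ {b q} → Tail b [] → ¬ b ℕ.≤ toℕ q
  Tail-[] tail b≤q with complete tail _ b≤q
  ... | ()

  Tail-head-least : ∀ {b h t q} → Tail b (h ∷ t) → b ℕ.≤ toℕ q → h F.≤ q
  Tail-head-least tail b≤q = Sorted-head-least (sorted tail) (complete tail _ b≤q)

  Tail-beyond-head : ∀ {b h t q} → Tail b (h ∷ t) → b ℕ.≤ toℕ q → q ≢ h → h F.< q
  Tail-beyond-head tail b≤q q≢h = FP.≤∧≢⇒< (Tail-head-least tail b≤q) (q≢h ∘ sym)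

  Tail-tail : ∀ {b h t} → Tail b (h ∷ t) → Tail (suc (toℕ h)) t
  Tail-tail {h = h} tail with sorted tail
  ... | h< ∷ sorted-t = record
    { sorted   = sorted-t
    ; complete = λ q h<q → in-tail (complete tail q (ℕP.≤-trans (bounded tail h (here refl)) (ℕP.<⇒≤ h<q))) h<q
    ; bounded  = λ q q∈t → All.lookup h< q∈t
    }
    where
    in-tail : ∀ {q} → q ∈ h ∷ _ → h F.< q → q ∈ _
    in-tail (here refl) h<h = ⊥-elim (FP.<-irrefl refl h<h)
    in-tail (there q∈t) _   = q∈t

  applyPositions : List (Fin nE) → Fin nV → Fin nV
  applyPositions L = applySeq G (map (ω ⟨$⟩ʳ_) L)

  first-move : ∀ {b} L x → Tail b L → (∀ q → Inc x q → b ℕ.≤ toℕ q) →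
               ∃[ t ] Tail (suc (toℕ (iv x))) t × applyPositions L x ≡ applyPositions t (Dart.v (f x))
  first-move []      x tail above = ⊥-elim (Tail-[] tail (above _ (inc (hiv x))))
  first-move (h ∷ t) x tail above with incident? G x (ω ⟨$⟩ʳ h)
  ... | yes inch with FP.≤-antisym (Tail-head-least tail (above _ (inc (hiv x)))) (min (hiv x) h inch)
  ...   | refl = t , Tail-tail tail , refl
  first-move (h ∷ t) x tail above | no ¬inch
    rewrite τ-fixes (ω ⟨$⟩ʳ h) x ¬inch =
      first-move t x (Tail-tail tail) λ q incq →
        Tail-beyond-head tail (above q incq) λ { refl → ¬inch incq }

  FaceWalk : Dart G → List (Fin nE) → Set
  FaceWalk d L = ∃[ k ] Terminal (iter φ k d) × Dart.v (iter φ k d) ≡ applyPositions L (Dart.v d) ×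
                        (∀ j → j ℕ.< k → Later (iter φ (suc j) d))

  FaceWalk-skip : ∀ {d h t} → ¬ Inc (Dart.v d) h → FaceWalk d t → FaceWalk d (h ∷ t)
  FaceWalk-skip {h = h} ¬inch walk rewrite τ-fixes (ω ⟨$⟩ʳ h) _ ¬inch = walk

  FaceWalk-step : ∀ {d h t} → Dart.v (φ d) ≡ τ G (ω ⟨$⟩ʳ h) (Dart.v d) → Later (φ d) →
                  FaceWalk (φ d) t → FaceWalk d (h ∷ t)
  FaceWalk-step {d} {h} {t} head≡ later-φd (k , term , head-k≡ , later) =
    suc k , subst Terminal (sym shift) term ,
    trans (cong Dart.v shift) (trans head-k≡ (cong (applyPositions t) head≡)) ,
    λ { zero _ → later-φd
      ; (suc j) (s≤s j<k) → subst Later (sym (iter-sucʳ φ (suc j) d)) (later j j<k) }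
    where
    shift : iter φ (suc k) d ≡ iter φ k (φ d)
    shift = iter-sucʳ φ k d

  face-walk : ∀ {b} L d → Tail b L → toℕ (pos d) ℕ.< b →
              (∀ q → Inc (Dart.v d) q → pos d F.< q → b ℕ.≤ toℕ q) → FaceWalk d L
  face-walk []      d tail _     gap = 0 , (λ r d<r incr → Tail-[] tail (gap r incr d<r)) , refl , λ _ ()
  face-walk (h ∷ t) d tail d<b gap with incident? G (Dart.v d) (ω ⟨$⟩ʳ h)
  ... | no ¬inch = FaceWalk-skip {t = t} ¬inch (face-walk t d (Tail-tail tail) (ℕP.m<n⇒m<1+n d<h) gap′)
    where
    d<h = ℕP.<-≤-trans d<b (bounded tail h (here refl))
    gap′ : ∀ q → Inc (Dart.v d) q → pos d F.< q → suc (toℕ h) ℕ.≤ toℕ q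
    gap′ q incq d<q = Tail-beyond-head tail (gap q incq d<q) λ { refl → ¬inch incq }
  ... | yes inch = FaceWalk-step {t = t} (At-head (φ d) next) later-φd
                     (face-walk t (φ d) (Tail-tail tail) (s≤s (ℕP.≤-reflexive (cong toℕ (proj₁ next)))) gap′)
    where
    d<h = ℕP.<-≤-trans d<b (bounded tail h (here refl))
    next : At h (Dart.v d) (φ d)
    next = φ-next d h inch d<h λ r d<r incr → Tail-head-least tail (gap r incr d<r)
    later-φd : Later (φ d)
    later-φd = subst₂ (λ v i → iv v F.< i) (sym (proj₂ next)) (sym (proj₁ next))
                 (ℕP.≤-<-trans (min (hiv (Dart.v d)) (pos d) (head-Inc d)) d<h)
    gap′ : ∀ q → Inc (Dart.v (φ d)) q → pos (φ d) F.< q → suc (toℕ h) ℕ.≤ toℕ q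
    gap′ q _ φd<q = subst (λ i → i F.< q) (proj₁ next) φd<q

  π : Fin nV → Fin nV
  π = πω G ω

  face-return : ∀ x → ∃[ k ] iter φ (suc k) (f x) ≡ f (π x) ×
                            (∀ j → j ℕ.< k → ∀ w → iter φ (suc j) (f x) ≢ f w)
  face-return x =
    let t , tail , π≡ = first-move (allFin nE) x Tail-allFin (λ _ _ → z≤n)
        k , term , head≡ , later = face-walk t (f x) tail (s≤s (ℕP.≤-reflexive (cong toℕ (proj₁ (f-At x))))) gap
    in  k , trans (φ-terminal _ term) (cong f (trans head≡ (sym π≡))) ,
        λ j j<k w → Later-≢-f (later j j<k)
    where
    gap : ∀ q → Inc (Dart.v (f x)) q → pos (f x) F.< q → suc (toℕ (iv x)) ℕ.≤ toℕ q
    gap q _ fx<q = subst (λ i → i F.< q) (proj₁ (f-At x)) fx<q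

  entering : ∀ q v → Inc v q → ∃[ c ] pos c ≡ q × Dart.v c ≡ v
  entering q v incq = α G out , trans (cong (ω ⟨$⟩ˡ_) (trans (α-edge out) (mkDart-edge _ v incq))) (inverseˡ ω) ,
                      trans (α-head out) (mkDart-tail _ v incq)
    where out = mkDart G (ω ⟨$⟩ʳ q) v incq

  -- The predecessor of d enters its tail along the last edge there before d's.
  φ-predecessor : ∀ d → Later d → ∃[ c ] pos c F.< pos d × φ c ≡ d
  φ-predecessor d later
    with lastBelow (λ i → incident? G (Dart.u d) (ω ⟨$⟩ʳ i)) (toℕ (pos d)) (FP.toℕ≤n (pos d))
                   (iv (Dart.u d) , later , inc (hiv (Dart.u d)))
  ... | q , q<d , incq , maximal with entering q (Dart.u d) incq
  ...   | c , refl , head≡ =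
    c , q<d , At-unique (φ-next c (pos d) (subst (λ v → Inc v (pos d)) (sym head≡) (tail-Inc d)) q<d least)
                        (refl , sym head≡)
    where
    least : ∀ r → pos c F.< r → Inc (Dart.v c) r → pos d F.≤ r
    least r c<r incr with r FP.<? pos d
    ... | yes r<d = ⊥-elim (ℕP.<-irrefl refl (ℕP.<-≤-trans c<r (maximal r r<d (subst (λ v → Inc v r) head≡ incr))))
    ... | no  r≮d = ℕP.≮⇒≥ r≮d

  φ-cover : ∀ d → ∃[ v ] SameOrbit φ (f v) d
  φ-cover d = go d (FinInd.<-wellFounded (pos d))
    where
    go : ∀ d → Acc F._<_ (pos d) → ∃[ v ] SameOrbit φ (f v) d
    go d (acc rs) with iv (Dart.u d) FP.≟ pos d
    ... | yes first = Dart.u d , 0 , At-unique (f-At (Dart.u d)) (sym first , refl)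
    ... | no ¬first with φ-predecessor d (FP.≤∧≢⇒< (min (hiv (Dart.u d)) (pos d) (tail-Inc d)) ¬first)
    ...   | c , c<d , refl = let v , k , orbit = go c (rs c<d) in v , suc k , cong φ orbit

lemma3p2 : (G : Graph) → Connected G → (ω : EdgeOrdering G) →
    (iv : Fin (Graph.nV G) → Fin (Graph.nE G)) →
    (hiv : ∀ v → IsFirstInc G ω v (iv v)) →
    ((∀ v w → SameOrbit (πω G ω) v w →
        SameOrbit (φω G ω) (fω G ω iv hiv v) (fω G ω iv hiv w)) ×
     (∀ v w → SameOrbit (φω G ω) (fω G ω iv hiv v) (fω G ω iv hiv w) →
        SameOrbit (πω G ω) v w) ×
     (∀ d → ∃[ v ] SameOrbit (φω G ω) (fω G ω iv hiv v) d)) ×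
    (∀ (k : ℕ) → NumOrbits (πω G ω) k ⇔ NumOrbits (φω G ω) k)
lemma3p2 G _ ω iv hiv =
  ((λ _ _ → orbit-preserved) , (λ _ _ → orbit-reflected) , φ-cover) ,
  NumOrbits-⇔ f orbit-preserved orbit-reflected φ-cover
  where
  open Faces G ω iv hiv
  open FirstReturn π φ f (cong Dart.u) face-return
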